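{- Let $G$ be a $3$-edge-connected graph, $v$ a vertex of $G$, and $G_v$ a local cubic modification of $G$ at $v$ that is $3$-edge-connected. Then $F(G_v)\ge F(G)$.
   Context: Graphs are finite and simple. Let $G$ have minimum degree at least $3$ and let $v$ be a vertex of degree $d\ge 3$ with neighbours $x_1,\dots,x_d$. A local cubic modification of $G$ at $v$ is any graph $G_v$ obtained by deleting $v$, adding a cycle $C_v$ on new vertices $v_1,\dots,v_d$, and adding a perfect matching between $\{x_1,\dots,x_d\}$ and $\{v_1,\dots,v_d\}$ (so each $v_j$ gets exactly one neighbour among the $x_i$). An orientation of a graph replaces each edge $uv$ by exactly one of the arcs $(u,v)$, $(v,u)$. An oriented graph is strongly connected if for any two vertices $x,y$ there is a directed $(x,y)$-path. In an orientation $O$ of $G$, an edge $e$ is deletable if $O-e$ is strongly connected. For a $3$-edge-connected graph $G$, the Frank number $F(G)$ is the minimum $k$ such that $G$ admits $k$ orientations with the property that every edge of $G$ is deletable in at least one of them. -}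

module Defs where

open import Data.Nat using (ℕ; zero; suc; _≤_; _≡ᵇ_)
open import Data.Bool using (Bool; T; _∨_; _∧_)
open import Data.Fin using (Fin; toℕ; punchIn; _≟_)
open import Data.Sum using (_⊎_; inj₁; inj₂)
open import Data.Product using (Σ; _×_; _,_)
open import Data.Empty using (⊥)
open import Relation.Nullary using (¬_; ⌊_⌋)
open import Relation.Binary.PropositionalEquality using (_≡_)
open import Relation.Binary.Construct.Closure.ReflexiveTransitive using (Star)

Graph : Set → Set
Graph V = V → V → Bool

Adj : {V : Set} → Graph V → V → V → Set
Adj G u v = T (G u v)

IsSimple : {V : Set} → Graph V → Set
IsSimple {V} G = (∀ u v → Adj G u v → Adj G v u) × (∀ u → ¬ Adj G u u)

SamePair : {V : Set} → V → V → V → V → Set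
SamePair a b u v = (a ≡ u × b ≡ v) ⊎ (a ≡ v × b ≡ u)

Connected : {V : Set} → (V → V → Set) → Set
Connected {V} R = ∀ (x y : V) → Star R x y

-- G minus the edges {a,b} and {c,d} (removing a non-edge does nothing)
Minus2 : {V : Set} → Graph V → V → V → V → V → V → V → Set
Minus2 G a b c d x y = Adj G x y × ¬ SamePair x y a b × ¬ SamePair x y c d

-- 3-edge-connected: at least two vertices, and G - F is connected for
-- every set F of at most two edges.
ThreeEdgeConnected : {V : Set} → Graph V → Set
ThreeEdgeConnected {V} G =
  (Σ V λ u → Σ V λ w → ¬ u ≡ w) ×
  (∀ (a b c d : V) → Connected (Minus2 G a b c d))

record Orientation {V : Set} (G : Graph V) : Set where
  field
    dir      : V → V → Bool
    arc⇒edge : ∀ u v → T (dir u v) → Adj G u v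
    edge⇒arc : ∀ u v → Adj G u v → T (dir u v) ⊎ T (dir v u)
    oneDir   : ∀ u v → ¬ (T (dir u v) × T (dir v u))

open Orientation public

Arc : {V : Set} {G : Graph V} → Orientation G → V → V → Set
Arc O u v = T (dir O u v)

StronglyConnected : {V : Set} → (V → V → Set) → Set
StronglyConnected {V} A = ∀ (x y : V) → Star A x y

ArcMinus : {V : Set} {G : Graph V} → Orientation G → V → V → V → V → Set
ArcMinus O u v a b = Arc O a b × ¬ SamePair a b u v

Deletable : {V : Set} {G : Graph V} → Orientation G → V → V → Set
Deletable O u v = StronglyConnected (ArcMinus O u v)

FrankFamily : {V : Set} → Graph V → ℕ → Set
FrankFamily G k =
  Σ (Fin k → Orientation G) λ Os →
    ∀ u v → Adj G u v → Σ (Fin k) λ i → Deletable (Os i) u v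

IsFrankNumber : {V : Set} → Graph V → ℕ → Set
IsFrankNumber G k = FrankFamily G k × (∀ j → FrankFamily G j → k ≤ j)

-- adjacency of the cycle v_0 v_1 ... v_{d-1} v_0 on Fin d (d ≥ 3)
cycAdj : (d : ℕ) → Fin d → Fin d → Bool
cycAdj d i j =
  (suc (toℕ i) ≡ᵇ toℕ j) ∨ (suc (toℕ j) ≡ᵇ toℕ i) ∨
  ((toℕ i ≡ᵇ 0) ∧ (suc (toℕ j) ≡ᵇ d)) ∨ ((toℕ j ≡ᵇ 0) ∧ (suc (toℕ i) ≡ᵇ d))

-- The local cubic modification of G (on Fin (suc n)) at v, where
-- x : Fin d → Fin (suc n) enumerates the neighbours of v.
-- Vertices: inj₁ a  is the old vertex  punchIn v a  (all vertices ≠ v),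
--           inj₂ j  is the new vertex  v_j.
-- New vertices form the cycle v_0 … v_{d-1}, and v_j is matched to x j.
-- (Every perfect matching / cycle arises from some enumeration x, up to
-- renaming the new vertices.)
localCubic : {n d : ℕ} → Graph (Fin (suc n)) → (v : Fin (suc n)) →
             (Fin d → Fin (suc n)) → Graph (Fin n ⊎ Fin d)
localCubic G v x (inj₁ a) (inj₁ b) = G (punchIn v a) (punchIn v b)
localCubic {d = d} G v x (inj₂ i) (inj₂ j) = cycAdj d i j
localCubic G v x (inj₁ a) (inj₂ j) = ⌊ x j ≟ punchIn v a ⌋
localCubic G v x (inj₂ i) (inj₁ b) = ⌊ x i ≟ punchIn v b ⌋

EnumeratesNeighbours : {n d : ℕ} → Graph (Fin (suc n)) → Fin (suc n) →
                       (Fin d → Fin (suc n)) → Set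
EnumeratesNeighbours {n} {d} G v x =
  (∀ (i j : Fin d) → x i ≡ x j → i ≡ j) ×
  (∀ (j : Fin d) → Adj G v (x j)) ×
  (∀ (w : Fin (suc n)) → Adj G v w → Σ (Fin d) λ j → x j ≡ w)

{-# OPTIONS --safe #-}
-- Contracting the cycle C_v of G_v back to the single vertex v maps the edges of G_v outside
-- C_v bijectively onto the edges of G.  An orientation of G_v therefore induces an orientation
-- of G, and contraction preserves directed paths, so an edge deletable in the former stays
-- deletable in the latter.  Thus every Frank family of G_v yields one of G of the same size.
-- (3-edge-connectivity only ensures that both Frank numbers exist; the proof does not use it.)
module Submission where

open import Defs
open import Data.Nat using (ℕ; suc; _≤_; s≤s)
open import Data.Bool using (Bool; false; T)
open import Data.Fin using (Fin; zero; punchIn; punchOut; _≟_)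
open import Data.Fin.Properties using (punchIn-injective; punchInᵢ≢i; punchIn-punchOut)
open import Data.Sum using (_⊎_; inj₁; inj₂; swap)
open import Data.Product using (Σ; _×_; _,_; proj₁; proj₂)
open import Data.Empty using (⊥-elim)
open import Function using (_∘_)
open import Relation.Nullary using (¬_; yes; no)
open import Relation.Nullary.Decidable using (T?; toWitness; fromWitness)
open import Relation.Binary.Definitions using (DecidableEquality)
open import Relation.Binary.PropositionalEquality
open import Relation.Binary.Construct.Closure.ReflexiveTransitive using (Star; ε; _◅_; kleisliStar)

Linked : {V : Set} → Graph V → V → V → Set
Linked G p q = Adj G p q ⊎ Adj G q p

Loopless : {V : Set} → Graph V → Set
Loopless G = ∀ u → ¬ Adj G u u

EdgeLift : {V′ V : Set} → Graph V′ → (V′ → V) → V → V → Set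
EdgeLift {V′} G′ f u w = Σ V′ λ p → Σ V′ λ q → f p ≡ u × f q ≡ w × Adj G′ p q

-- f contracts G′ onto G: edges of G′ whose ends are not identified correspond exactly to
-- the edges of G; edges inside a fibre of f are forgotten.
record IsContraction {V′ V : Set} (G′ : Graph V′) (G : Graph V) (f : V′ → V) : Set where
  field
    surjective  : ∀ u → Σ V′ λ p → f p ≡ u
    edge-image  : ∀ p q → Adj G′ p q → ¬ f p ≡ f q → Adj G (f p) (f q)
    edge-lift   : ∀ u w → Adj G u w → EdgeLift G′ f u w
    lift-unique : ∀ {p q p′ q′} → Linked G′ p q → Linked G′ p′ q′ →
                  f p ≡ f p′ → f q ≡ f q′ → ¬ f p ≡ f q → p ≡ p′ × q ≡ q′

module Contraction {V′ V : Set} (_≟ᵥ_ : DecidableEquality V) {G′ : Graph V′} {G : Graph V}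
                   (loopless : Loopless G) {f : V′ → V} (c : IsContraction G′ G f) where
  open IsContraction c

  ends-distinct : ∀ {u w} → Adj G u w → ¬ u ≡ w
  ends-distinct {u} h refl = loopless u h

  module Induced (O′ : Orientation G′) where
    -- An edge of G is oriented like its unique lift in G′.
    induced-dir : V → V → Bool
    induced-dir u w with T? (G u w)
    ... | yes h = let (p , q , _) = edge-lift u w h in dir O′ p q
    ... | no _  = false

    arc-image : ∀ {s t} → Arc O′ s t → ¬ f s ≡ f t → T (induced-dir (f s) (f t))
    arc-image {s} {t} a ne with T? (G (f s) (f t))
    ... | no ¬h = ⊥-elim (¬h (edge-image s t (arc⇒edge O′ s t a) ne))
    ... | yes h with edge-lift (f s) (f t) h
    ...   | p , q , fp , fq , e
      with lift-unique (inj₁ e) (inj₁ (arc⇒edge O′ s t a)) fp fq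
                       (ends-distinct (subst₂ (Adj G) (sym fp) (sym fq) h))
    ...     | refl , refl = a

    induced : Orientation G
    dir induced = induced-dir
    arc⇒edge induced u w _ with T? (G u w)
    ... | yes h = h
    edge⇒arc induced u w h with T? (G u w)
    ... | no ¬h = ⊥-elim (¬h h)
    ... | yes h′ with edge-lift u w h′
    ...   | p , q , refl , refl , e with edge⇒arc O′ p q e
    ...     | inj₁ a = inj₁ a
    ...     | inj₂ a = inj₂ (arc-image a (ends-distinct h′ ∘ sym))
    oneDir induced u w (d₁ , d₂) with T? (G u w) | T? (G w u)
    ... | yes h | yes h′ with edge-lift u w h | edge-lift w u h′
    ...   | p , q , refl , refl , e | p′ , q′ , fp′ , fq′ , e′
      with lift-unique (inj₂ e) (inj₁ e′) (sym fp′) (sym fq′) (ends-distinct h ∘ sym)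
    ...     | refl , refl = oneDir O′ p q (d₁ , d₂)

    arcMinus-image : ∀ {p q s t} → Adj G′ p q → ArcMinus O′ p q s t →
                     Star (ArcMinus induced (f p) (f q)) (f s) (f t)
    arcMinus-image {p} {q} {s} {t} e (a , ¬pq) with f s ≟ᵥ f t
    ... | yes fs≡ft = subst (Star _ (f s)) fs≡ft ε
    ... | no ne = (arc-image a ne , ¬same) ◅ ε
      where
      ¬same : ¬ SamePair (f s) (f t) (f p) (f q)
      ¬same (inj₁ (fs≡fp , ft≡fq)) =
        ¬pq (inj₁ (lift-unique (inj₁ (arc⇒edge O′ s t a)) (inj₁ e) fs≡fp ft≡fq ne))
      ¬same (inj₂ (fs≡fq , ft≡fp)) =
        ¬pq (inj₂ (lift-unique (inj₁ (arc⇒edge O′ s t a)) (inj₂ e) fs≡fq ft≡fp ne))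

    deletable-image : ∀ {p q} → Adj G′ p q → Deletable O′ p q → Deletable induced (f p) (f q)
    deletable-image e del u w with surjective u | surjective w
    ... | s , refl | t , refl = kleisliStar f (arcMinus-image e) (del s t)

  open Induced using (induced; deletable-image)

  frankFamily-image : ∀ {k} → FrankFamily G′ k → FrankFamily G k
  frankFamily-image (Os , covers) = induced ∘ Os , cover
    where
    cover : ∀ u w → Adj G u w → Σ _ λ i → Deletable (induced (Os i)) u w
    cover u w h with edge-lift u w h
    ... | p , q , refl , refl , e with covers p q e
    ...   | i , del = i , deletable-image (Os i) e del

  frankNumber-≤ : ∀ {k k′} → IsFrankNumber G k → IsFrankNumber G′ k′ → k ≤ k′
  frankNumber-≤ (_ , minimal) (family′ , _) = minimal _ (frankFamily-image family′)

module LocalCubic {n d : ℕ} {G : Graph (Fin (suc n))} {v : Fin (suc n)} {x : Fin d → Fin (suc n)}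
                  (simple : IsSimple G) (enum : EnumeratesNeighbours G v x) where
  private
    G′ = localCubic G v x
    symmetric = proj₁ simple
    x-injective = proj₁ enum
    x-adjacent = proj₁ (proj₂ enum)
    x-onto = proj₂ (proj₂ enum)

  contractCycle : Fin n ⊎ Fin d → Fin (suc n)
  contractCycle (inj₁ a) = punchIn v a
  contractCycle (inj₂ _) = v

  contractCycle-old : ∀ p a → contractCycle p ≡ punchIn v a → p ≡ inj₁ a
  contractCycle-old (inj₁ a′) a e = cong inj₁ (punchIn-injective v a′ a e)
  contractCycle-old (inj₂ j) a e = ⊥-elim (punchInᵢ≢i v a (sym e))

  linked-matched : ∀ {a j} → Linked G′ (inj₁ a) (inj₂ j) → x j ≡ punchIn v a
  linked-matched (inj₁ h) = toWitness h
  linked-matched (inj₂ h) = toWitness h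

  contractCycle-surjective : Fin d → ∀ u → Σ (Fin n ⊎ Fin d) λ p → contractCycle p ≡ u
  contractCycle-surjective j u with v ≟ u
  ... | yes v≡u = inj₂ j , v≡u
  ... | no v≢u = inj₁ (punchOut v≢u) , punchIn-punchOut v≢u

  contractCycle-edge-image : ∀ p q → Adj G′ p q → ¬ contractCycle p ≡ contractCycle q →
                             Adj G (contractCycle p) (contractCycle q)
  contractCycle-edge-image (inj₁ a) (inj₁ b) h _ = h
  contractCycle-edge-image (inj₁ a) (inj₂ j) h _ =
    symmetric v (punchIn v a) (subst (Adj G v) (toWitness h) (x-adjacent j))
  contractCycle-edge-image (inj₂ j) (inj₁ b) h _ = subst (Adj G v) (toWitness h) (x-adjacent j)
  contractCycle-edge-image (inj₂ i) (inj₂ j) _ ne = ⊥-elim (ne refl)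

  contractCycle-edge-lift : ∀ u w → Adj G u w → EdgeLift G′ contractCycle u w
  contractCycle-edge-lift u w h with v ≟ u | v ≟ w
  ... | yes refl | yes refl = ⊥-elim (proj₂ simple v h)
  ... | yes refl | no v≢w with x-onto w h
  ...   | j , xj≡w = inj₂ j , inj₁ (punchOut v≢w) , refl , punchIn-punchOut v≢w ,
                     fromWitness (trans xj≡w (sym (punchIn-punchOut v≢w)))
  contractCycle-edge-lift u w h | no v≢u | yes refl with x-onto u (symmetric u v h)
  ...   | j , xj≡u = inj₁ (punchOut v≢u) , inj₂ j , punchIn-punchOut v≢u , refl ,
                     fromWitness (trans xj≡u (sym (punchIn-punchOut v≢u)))
  contractCycle-edge-lift u w h | no v≢u | no v≢w =
    inj₁ (punchOut v≢u) , inj₁ (punchOut v≢w) , punchIn-punchOut v≢u , punchIn-punchOut v≢w ,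
    subst₂ (Adj G) (sym (punchIn-punchOut v≢u)) (sym (punchIn-punchOut v≢w)) h

  -- An edge leaving the cycle is determined by its old end, because x is injective.
  contractCycle-lift-unique : ∀ {p q p′ q′} → Linked G′ p q → Linked G′ p′ q′ →
                              contractCycle p ≡ contractCycle p′ → contractCycle q ≡ contractCycle q′ →
                              ¬ contractCycle p ≡ contractCycle q → p ≡ p′ × q ≡ q′
  contractCycle-lift-unique {inj₁ a} {inj₁ b} {p′} {q′} _ _ e₁ e₂ _ =
    sym (contractCycle-old p′ a (sym e₁)) , sym (contractCycle-old q′ b (sym e₂))
  contractCycle-lift-unique {inj₁ a} {inj₂ j} {q′ = inj₁ b} _ _ _ e₂ _ =
    ⊥-elim (punchInᵢ≢i v b (sym e₂))
  contractCycle-lift-unique {inj₁ a} {inj₂ j} {p′} {inj₂ j′} h h′ e₁ _ _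
    with contractCycle-old p′ a (sym e₁)
  ... | refl = refl , cong inj₂ (x-injective j j′ (trans (linked-matched h) (sym (linked-matched h′))))
  contractCycle-lift-unique {inj₂ j} {inj₁ b} {inj₁ a} _ _ e₁ _ _ =
    ⊥-elim (punchInᵢ≢i v a (sym e₁))
  contractCycle-lift-unique {inj₂ j} {inj₁ b} {inj₂ j′} {q′} h h′ _ e₂ _
    with contractCycle-old q′ b (sym e₂)
  ... | refl = cong inj₂ (x-injective j j′ (trans (linked-matched (swap h))
                                                 (sym (linked-matched (swap h′))))) , refl
  contractCycle-lift-unique {inj₂ j} {inj₂ j′} _ _ _ _ ne = ⊥-elim (ne refl)

  contractCycle-isContraction : Fin d → IsContraction G′ G contractCycle
  contractCycle-isContraction j = record
    { surjective  = contractCycle-surjective j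
    ; edge-image  = contractCycle-edge-image
    ; edge-lift   = contractCycle-edge-lift
    ; lift-unique = contractCycle-lift-unique
    }

lemma3p2 : (n d : ℕ) (G : Graph (Fin (suc n))) (v : Fin (suc n))
           (x : Fin d → Fin (suc n)) →
           IsSimple G → ThreeEdgeConnected G → 3 ≤ d →
           EnumeratesNeighbours G v x →
           ThreeEdgeConnected (localCubic G v x) →
           (k kv : ℕ) → IsFrankNumber G k → IsFrankNumber (localCubic G v x) kv →
           k ≤ kv
lemma3p2 n d G v x simple _ (s≤s _) enum _ k kv =
  Contraction.frankNumber-≤ _≟_ (proj₂ simple) (LocalCubic.contractCycle-isContraction simple enum zero)
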